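{- Let $t\ge 1$ and $q\ge 2$. Then $L(tS_{q,q,q})\xrightarrow{\cap}tS_{q-1,q-1,q}$.
   Context: All graphs are finite and simple. For graphs $G_1=(V_1,E_1)$, $G_2=(V_2,E_2)$, $G_1\cap G_2=(V_1\cap V_2,E_1\cap E_2)$. For $G=(V,E)$ and an injective map $\alpha$ on $V$, $G^{\alpha}$ has vertex set $\alpha(V)$ and edge set $\{\{\alpha(v),\alpha(w)\}:\{v,w\}\in E\}$. We write $G\xrightarrow{\cap}H$ if $H=G^{\alpha_1}\cap\cdots\cap G^{\alpha_k}$ for some injective maps $\alpha_1,\dots,\alpha_k$ on $V(G)$ (up to isomorphism of $H$). For positive integers $a,b,c$, $S_{a,b,c}$ is the tree consisting of a central vertex together with three paths attached at it having $a$, $b$, $c$ edges respectively (so $S_{q,q,q}$ is $K_{1,3}$ with each edge subdivided by $q-1$ new vertices). $tS_{a,b,c}$ is the disjoint union of $t$ copies of $S_{a,b,c}$. $L(G)$ is the line graph of $G$. -}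

module Defs where

open import Data.Nat using (ℕ; zero; suc; _+_; _≡ᵇ_)
open import Data.Bool using (Bool; true; false; _∨_; _∧_; not)
open import Data.Fin using (Fin; toℕ; splitAt; _<_)
open import Data.Sum using (_⊎_; inj₁; inj₂)
open import Data.Product using (Σ; Σ-syntax; ∃; ∃-syntax; _×_; proj₁; proj₂)
open import Relation.Binary.PropositionalEquality using (_≡_; _≢_)
open import Function.Definitions using (Injective)

-- Graphs.  A general graph: a vertex type and an adjacency relation.
-- (All concrete graphs below are finite, simple: adjacency is symmetric
-- and irreflexive by construction.)

record Graph : Set₁ where
  field
    V   : Set
    Adj : V → V → Set

open Graph public

record FinGraph : Set where
  field
    n   : ℕ
    adj : Fin n → Fin n → Bool

open FinGraph public

toGraph : FinGraph → Graph
toGraph G = record { V = Fin (n G) ; Adj = λ i j → adj G i j ≡ true }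

-- The spider S_{a,b,c} (a,b,c ≥ 1) on vertices 0 .. a+b+c:
-- 0 is the centre, 1..a is the first leg (vertex i at distance i),
-- a+1..a+b the second leg, a+b+1..a+b+c the third leg.

-- step a b c u v = true iff {u,v} is an edge with u < v.
step : ℕ → ℕ → ℕ → ℕ → ℕ → Bool
step a b c zero    v = (v ≡ᵇ 1) ∨ ((v ≡ᵇ suc a) ∨ (v ≡ᵇ suc (a + b)))
step a b c (suc u) v = (v ≡ᵇ suc (suc u)) ∧ (not (suc u ≡ᵇ a) ∧ not (suc u ≡ᵇ a + b))

S : ℕ → ℕ → ℕ → FinGraph
S a b c = record
  { n   = suc (a + b + c)
  ; adj = λ i j → step a b c (toℕ i) (toℕ j) ∨ step a b c (toℕ j) (toℕ i)
  }

_⊕_ : FinGraph → FinGraph → FinGraph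
G ⊕ H = record { n = n G + n H ; adj = λ i j → go (splitAt (n G) i) (splitAt (n G) j) }
  where
  go : Fin (n G) ⊎ Fin (n H) → Fin (n G) ⊎ Fin (n H) → Bool
  go (inj₁ x) (inj₁ y) = adj G x y
  go (inj₂ x) (inj₂ y) = adj H x y
  go (inj₁ _) (inj₂ _) = false
  go (inj₂ _) (inj₁ _) = false

copies : ℕ → FinGraph → FinGraph
copies zero    G = record { n = 0 ; adj = λ () }
copies (suc t) G = G ⊕ copies t G

EdgeOf : FinGraph → Set
EdgeOf G = Σ[ i ∈ Fin (n G) ] Σ[ j ∈ Fin (n G) ] (i < j × adj G i j ≡ true)

src tgt : {G : FinGraph} → EdgeOf G → Fin (n G)
src e = proj₁ e
tgt e = proj₁ (proj₂ e)

L : FinGraph → Graph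
L G = record
  { V   = EdgeOf G
  ; Adj = λ e f → e ≢ f ×
            ((src {G} e ≡ src {G} f ⊎ src {G} e ≡ tgt {G} f) ⊎
             (tgt {G} e ≡ src {G} f ⊎ tgt {G} e ≡ tgt {G} f))
  }

-- The injective maps α₁..α_k (k ≥ 1) take values in a common ambient
-- set, taken to be ℕ (all images are finite).  G^{α₁} ∩ ... ∩ G^{α_k}
-- has vertex set ⋂ᵢ αᵢ(V) and edge set ⋂ᵢ {{αᵢ v, αᵢ w} : v ~ w}.
-- "H ≅ G^{α₁} ∩ ... ∩ G^{α_k}" is expressed by an injective map
-- f : V(H) → ℕ whose image is exactly that vertex set and which maps
-- adjacency of H exactly onto the edge set of the intersection.

record IsIntersectionIso (G H : Graph) (k : ℕ) (α : Fin k → V G → ℕ) : Set where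
  field
    f        : V H → ℕ
    f-inj    : Injective _≡_ _≡_ f
    vert→    : ∀ u → (∀ i → ∃[ v ] α i v ≡ u) → ∃[ h ] f h ≡ u
    vert←    : ∀ u → (∃[ h ] f h ≡ u) → ∀ i → ∃[ v ] α i v ≡ u
    edge→    : ∀ h h' → Adj H h h' →
                 ∀ i → ∃[ v ] ∃[ w ] (α i v ≡ f h × α i w ≡ f h' × Adj G v w)
    edge←    : ∀ h h' →
                 (∀ i → ∃[ v ] ∃[ w ] (α i v ≡ f h × α i w ≡ f h' × Adj G v w)) →
                 Adj H h h'

_→∩_ : Graph → Graph → Set
G →∩ H = Σ[ k ∈ ℕ ] Σ[ α ∈ (Fin (suc k) → V G → ℕ) ]
           ((∀ i → Injective _≡_ _≡_ (α i)) × IsIntersectionIso G H (suc k) α)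

-- Name the edges of S_{q,q,q} by their lower endpoints A₀ … A_{q-1}, B₀ …, C₀ …: in the line
-- graph A₀ B₀ C₀ form a triangle and each leg is a path hanging from it. Intersect the identity
-- labelling with the labelling that reflects the path ⋯ C₁ C₀ A₀ A₁ ⋯ about A₀ and fixes the
-- B-leg. The common labels are all except C_{q-1}; of the triangle only A₀B₀ and A₀C₀ survive,
-- and the legs survive. This is S_{q-1,q-1,q} centred at A₀ with legs A₁…, C₀… and B₀….
-- For t copies the construction is done copywise, keeping the copies apart by interleaving
-- their labels as even and odd numbers.

module Submission where

open import Defs
open import Data.Nat using (ℕ; zero; suc; _+_; _*_; _≤_; _<_; _∸_; z≤n; s≤s; z<s; _≡ᵇ_; _<?_)
open import Data.Nat.Properties
open import Data.Fin as Fin using (Fin; toℕ; splitAt; join; _↑ˡ_; _↑ʳ_; fromℕ<)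
open import Data.Fin.Properties as FinP
  using (toℕ-injective; toℕ-↑ˡ; toℕ-↑ʳ; ↑ˡ-injective; ↑ʳ-injective; splitAt-↑ˡ; splitAt-↑ʳ;
         join-splitAt; splitAt-join; toℕ-fromℕ<; toℕ≤pred[n])
open import Data.Bool as Bool using (Bool; true; false; _∨_; not; T)
open import Data.Bool.Properties using (T-≡; T-∨; T-∧; T-not-≡)
open import Data.Sum as Sum using (_⊎_; inj₁; inj₂; [_,_])
open import Data.Sum.Properties using (inj₁-injective; inj₂-injective)
open import Data.Product using (Σ; Σ-syntax; ∃-syntax; _×_; _,_; proj₁; proj₂)
open import Data.Empty using (⊥-elim)
open import Data.Unit using (⊤; tt)
open import Relation.Nullary using (¬_; yes; no; contradiction)
open import Relation.Binary.PropositionalEquality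
  using (_≡_; _≢_; refl; sym; trans; cong; cong₂; subst; subst₂; module ≡-Reasoning)
open import Function using (_∘_)
open import Function.Bundles using (_⇔_; mk⇔; Equivalence)
open import Function.Properties.Equivalence using () renaming (trans to ⇔-trans)
open import Data.Sum.Function.Propositional using (_⊎-⇔_)
open import Data.Product.Function.NonDependent.Propositional using (_×-⇔_)
open import Function.Definitions using (Injective)
open import Axiom.UniquenessOfIdentityProofs using (module Decidable⇒UIP)

open Equivalence using () renaming (to to ⇒; from to ⇐)

-- Graph isomorphisms

infix 4 _≅_

record _≅_ (G H : Graph) : Set where
  field
    to      : V G → V H
    from    : V H → V G
    from∘to : ∀ x → from (to x) ≡ x
    to∘from : ∀ y → to (from y) ≡ y
    to-adj  : ∀ x y → Adj G x y ⇔ Adj H (to x) (to y)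

  to-injective : Injective _≡_ _≡_ to
  to-injective {x} {x'} eq = trans (sym (from∘to x)) (trans (cong from eq) (from∘to x'))

  from-injective : Injective _≡_ _≡_ from
  from-injective {y} {y'} eq = trans (sym (to∘from y)) (trans (cong to eq) (to∘from y'))

  from-adj : ∀ y y' → Adj H y y' ⇔ Adj G (from y) (from y')
  from-adj y y' = mk⇔
    (λ a → ⇐ (to-adj _ _) (subst₂ (Adj H) (sym (to∘from y)) (sym (to∘from y')) a))
    (λ a → subst₂ (Adj H) (to∘from y) (to∘from y') (⇒ (to-adj _ _) a))

≅-trans : ∀ {G H K} → G ≅ H → H ≅ K → G ≅ K
≅-trans φ ψ = record
  { to      = ψ.to ∘ φ.to
  ; from    = φ.from ∘ ψ.from
  ; from∘to = λ x → trans (cong φ.from (ψ.from∘to (φ.to x))) (φ.from∘to x)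
  ; to∘from = λ z → trans (cong ψ.to (φ.to∘from (ψ.from z))) (ψ.to∘from z)
  ; to-adj  = λ x y → mk⇔ (⇒ (ψ.to-adj _ _) ∘ ⇒ (φ.to-adj x y)) (⇐ (φ.to-adj x y) ∘ ⇐ (ψ.to-adj _ _))
  }
  where
  module φ = _≅_ φ
  module ψ = _≅_ ψ

-- Intersections of injective images in an arbitrary ambient set

record IsIntersectionIsoIn (T : Set) (G H : Graph) (k : ℕ) (α : Fin k → V G → T) : Set where
  field
    f        : V H → T
    f-inj    : Injective _≡_ _≡_ f
    vert→    : ∀ u → (∀ i → ∃[ v ] α i v ≡ u) → ∃[ h ] f h ≡ u
    vert←    : ∀ u → (∃[ h ] f h ≡ u) → ∀ i → ∃[ v ] α i v ≡ u
    edge→    : ∀ h h' → Adj H h h' →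
                 ∀ i → ∃[ v ] ∃[ w ] (α i v ≡ f h × α i w ≡ f h' × Adj G v w)
    edge←    : ∀ h h' →
                 (∀ i → ∃[ v ] ∃[ w ] (α i v ≡ f h × α i w ≡ f h' × Adj G v w)) →
                 Adj H h h'

Intersection : Set → ℕ → Graph → Graph → Set
Intersection T k G H = Σ[ α ∈ (Fin (suc k) → V G → T) ]
  ((∀ i → Injective _≡_ _≡_ (α i)) × IsIntersectionIsoIn T G H (suc k) α)

Intersection⇒→∩ : ∀ {k G H} → Intersection ℕ k G H → G →∩ H
Intersection⇒→∩ {k} (α , α-inj , I) = k , α , α-inj , record { IsIntersectionIsoIn I }

Intersection-encode : ∀ {T U k G H} (e : T → U) → Injective _≡_ _≡_ e →
                      Intersection T k G H → Intersection U k G H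
Intersection-encode e e-inj (α , α-inj , I) =
  (λ i → e ∘ α i) , (λ i → α-inj i ∘ e-inj) , record
    { f     = e ∘ I.f
    ; f-inj = I.f-inj ∘ e-inj
    ; vert→ = vert→
    ; vert← = λ { _ (h , refl) i → let v , p = I.vert← _ (h , refl) i in v , cong e p }
    ; edge→ = λ h h' a i → let v , w , p , q , r = I.edge→ h h' a i in v , w , cong e p , cong e q , r
    ; edge← = λ h h' P → I.edge← h h' λ i → let v , w , p , q , r = P i in v , w , e-inj p , e-inj q , r
    }
  where
  module I = IsIntersectionIsoIn I
  vert→ : ∀ u → (∀ i → ∃[ v ] e (α i v) ≡ u) → ∃[ h ] e (I.f h) ≡ u
  vert→ u P with P Fin.zero
  ... | v₀ , refl = let h , p = I.vert→ _ (λ i → let v , q = P i in v , e-inj q) in h , cong e p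

Intersection-resp-≅ : ∀ {T k G G' H H'} → G ≅ G' → H ≅ H' →
                      Intersection T k G H → Intersection T k G' H'
Intersection-resp-≅ φ ψ (α , α-inj , I) =
  (λ i → α i ∘ φ.from) , (λ i → φ.from-injective ∘ α-inj i) , record
    { f     = I.f ∘ ψ.from
    ; f-inj = ψ.from-injective ∘ I.f-inj
    ; vert→ = λ u P → let h , p = I.vert→ u (λ i → let v , q = P i in φ.from v , q) in
                      ψ.to h , trans (cong I.f (ψ.from∘to h)) p
    ; vert← = λ { u (h , p) i → let v , q = I.vert← u (ψ.from h , p) i in
                      φ.to v , trans (cong (α i) (φ.from∘to v)) q }
    ; edge→ = λ h h' a i →
        let v , w , p , q , r = I.edge→ _ _ (⇒ (ψ.from-adj h h') a) i in
        φ.to v , φ.to w , trans (cong (α i) (φ.from∘to v)) p ,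
        trans (cong (α i) (φ.from∘to w)) q , ⇒ (φ.to-adj v w) r
    ; edge← = λ h h' P → ⇐ (ψ.from-adj h h') (I.edge← _ _ λ i →
        let v , w , p , q , r = P i in φ.from v , φ.from w , p , q , ⇒ (φ.from-adj v w) r)
    }
  where
  module I = IsIntersectionIsoIn I
  module φ = _≅_ φ
  module ψ = _≅_ ψ

Intersection-empty : ∀ {T k G H} → ¬ V G → ¬ V H → Intersection T k G H
Intersection-empty ¬G ¬H = (λ _ v → ⊥-elim (¬G v)) , (λ _ {v} → ⊥-elim (¬G v)) , record
  { f     = λ h → ⊥-elim (¬H h)
  ; f-inj = λ {h} → ⊥-elim (¬H h)
  ; vert→ = λ _ P → ⊥-elim (¬G (proj₁ (P Fin.zero)))
  ; vert← = λ _ P → ⊥-elim (¬H (proj₁ P))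
  ; edge→ = λ h → ⊥-elim (¬H h)
  ; edge← = λ h → ⊥-elim (¬H h)
  }

-- Disjoint unions

data SumAdj (G H : Graph) : V G ⊎ V H → V G ⊎ V H → Set where
  left  : ∀ {x y} → Adj G x y → SumAdj G H (inj₁ x) (inj₁ y)
  right : ∀ {x y} → Adj H x y → SumAdj G H (inj₂ x) (inj₂ y)

infixr 5 _⊎ᴳ_

_⊎ᴳ_ : Graph → Graph → Graph
G ⊎ᴳ H = record { V = V G ⊎ V H ; Adj = SumAdj G H }

Intersection-⊎ : ∀ {T k G₁ G₂ H₁ H₂} → Intersection T k G₁ H₁ → Intersection T k G₂ H₂ →
                 Intersection (T ⊎ T) k (G₁ ⊎ᴳ G₂) (H₁ ⊎ᴳ H₂)
Intersection-⊎ {T} {k} {G₁} {G₂} {H₁} {H₂} (α₁ , α₁-inj , I₁) (α₂ , α₂-inj , I₂) =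
  α , α-inj , record
    { f = f ; f-inj = f-inj ; vert→ = vert→ ; vert← = vert← ; edge→ = edge→ ; edge← = edge← }
  where
  module I₁ = IsIntersectionIsoIn I₁
  module I₂ = IsIntersectionIsoIn I₂

  α : Fin (suc k) → V G₁ ⊎ V G₂ → T ⊎ T
  α i = Sum.map (α₁ i) (α₂ i)

  α-inj : ∀ i → Injective _≡_ _≡_ (α i)
  α-inj i {inj₁ _} {inj₁ _} eq = cong inj₁ (α₁-inj i (inj₁-injective eq))
  α-inj i {inj₂ _} {inj₂ _} eq = cong inj₂ (α₂-inj i (inj₂-injective eq))

  f : V H₁ ⊎ V H₂ → T ⊎ T
  f = Sum.map I₁.f I₂.f

  f-inj : Injective _≡_ _≡_ f
  f-inj {inj₁ _} {inj₁ _} eq = cong inj₁ (I₁.f-inj (inj₁-injective eq))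
  f-inj {inj₂ _} {inj₂ _} eq = cong inj₂ (I₂.f-inj (inj₂-injective eq))

  vert→ : ∀ u → (∀ i → ∃[ v ] α i v ≡ u) → ∃[ h ] f h ≡ u
  vert→ u P with P Fin.zero
  ... | inj₁ v₀ , refl = let h , p = I₁.vert→ _ (λ i → restrict (P i)) in inj₁ h , cong inj₁ p
    where
    restrict : ∀ {i} → ∃[ v ] α i v ≡ inj₁ (α₁ Fin.zero v₀) → ∃[ v ] α₁ i v ≡ α₁ Fin.zero v₀
    restrict (inj₁ v , eq) = v , inj₁-injective eq
  ... | inj₂ v₀ , refl = let h , p = I₂.vert→ _ (λ i → restrict (P i)) in inj₂ h , cong inj₂ p
    where
    restrict : ∀ {i} → ∃[ v ] α i v ≡ inj₂ (α₂ Fin.zero v₀) → ∃[ v ] α₂ i v ≡ α₂ Fin.zero v₀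
    restrict (inj₂ v , eq) = v , inj₂-injective eq

  vert← : ∀ u → (∃[ h ] f h ≡ u) → ∀ i → ∃[ v ] α i v ≡ u
  vert← _ (inj₁ h , refl) i = let v , p = I₁.vert← _ (h , refl) i in inj₁ v , cong inj₁ p
  vert← _ (inj₂ h , refl) i = let v , p = I₂.vert← _ (h , refl) i in inj₂ v , cong inj₂ p

  edge→ : ∀ h h' → SumAdj H₁ H₂ h h' → ∀ i → ∃[ v ] ∃[ w ] (α i v ≡ f h × α i w ≡ f h' × SumAdj G₁ G₂ v w)
  edge→ _ _ (left a) i = let v , w , p , q , r = I₁.edge→ _ _ a i in
    inj₁ v , inj₁ w , cong inj₁ p , cong inj₁ q , left r
  edge→ _ _ (right a) i = let v , w , p , q , r = I₂.edge→ _ _ a i in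
    inj₂ v , inj₂ w , cong inj₂ p , cong inj₂ q , right r

  edge← : ∀ h h' → (∀ i → ∃[ v ] ∃[ w ] (α i v ≡ f h × α i w ≡ f h' × SumAdj G₁ G₂ v w)) →
          SumAdj H₁ H₂ h h'
  edge← (inj₁ h) (inj₁ h') P = left (I₁.edge← h h' λ i → restrict (P i))
    where
    restrict : ∀ {i} → ∃[ v ] ∃[ w ] (α i v ≡ inj₁ (I₁.f h) × α i w ≡ inj₁ (I₁.f h') × SumAdj G₁ G₂ v w) →
               ∃[ v ] ∃[ w ] (α₁ i v ≡ I₁.f h × α₁ i w ≡ I₁.f h' × Adj G₁ v w)
    restrict (_ , _ , p , q , left r) = _ , _ , inj₁-injective p , inj₁-injective q , r
  edge← (inj₂ h) (inj₂ h') P = right (I₂.edge← h h' λ i → restrict (P i))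
    where
    restrict : ∀ {i} → ∃[ v ] ∃[ w ] (α i v ≡ inj₂ (I₂.f h) × α i w ≡ inj₂ (I₂.f h') × SumAdj G₁ G₂ v w) →
               ∃[ v ] ∃[ w ] (α₂ i v ≡ I₂.f h × α₂ i w ≡ I₂.f h' × Adj G₂ v w)
    restrict (_ , _ , p , q , right r) = _ , _ , inj₂-injective p , inj₂-injective q , r
  edge← (inj₁ h) (inj₂ h') P with P Fin.zero
  ... | _ , _ , _ , () , left _
  ... | _ , _ , () , _ , right _
  edge← (inj₂ h) (inj₁ h') P with P Fin.zero
  ... | _ , _ , () , _ , left _
  ... | _ , _ , _ , () , right _

interleave : ℕ ⊎ ℕ → ℕ
interleave (inj₁ m) = 2 * m
interleave (inj₂ n) = suc (2 * n)

interleave-injective : Injective _≡_ _≡_ interleave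
interleave-injective {inj₁ m} {inj₁ n} eq = cong inj₁ (*-cancelˡ-≡ m n 2 eq)
interleave-injective {inj₂ m} {inj₂ n} eq = cong inj₂ (*-cancelˡ-≡ m n 2 (suc-injective eq))
interleave-injective {inj₁ m} {inj₂ n} eq = contradiction eq (even≢odd m n)
interleave-injective {inj₂ m} {inj₁ n} eq = contradiction (sym eq) (even≢odd n m)

-- Adj (L G) e f is e ≢ f × Meet (src e) (tgt e) (src f) (tgt f).
Meet : {A : Set} → A → A → A → A → Set
Meet a b c d = (a ≡ c ⊎ a ≡ d) ⊎ (b ≡ c ⊎ b ≡ d)

module _ {A B : Set} {a b c d : A} where

  Meet-map : (φ : A → B) → Meet a b c d → Meet (φ a) (φ b) (φ c) (φ d)
  Meet-map φ = Sum.map (Sum.map (cong φ) (cong φ)) (Sum.map (cong φ) (cong φ))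

  Meet-unmap : {φ : A → B} → Injective _≡_ _≡_ φ → Meet (φ a) (φ b) (φ c) (φ d) → Meet a b c d
  Meet-unmap inj = Sum.map (Sum.map inj inj) (Sum.map inj inj)

Meet-disjoint : ∀ {A B C : Set} {φ : A → C} {ψ : B → C} → (∀ x y → φ x ≢ ψ y) →
                ∀ {a b c d} → ¬ Meet (φ a) (φ b) (ψ c) (ψ d)
Meet-disjoint φ≢ψ = [ [ φ≢ψ _ _ , φ≢ψ _ _ ] , [ φ≢ψ _ _ , φ≢ψ _ _ ] ]

EdgeOf-≡ : ∀ {G} {e e' : EdgeOf G} → src {G} e ≡ src {G} e' → tgt {G} e ≡ tgt {G} e' → e ≡ e'
EdgeOf-≡ {e = i , j , lt , a} {.i , .j , lt' , a'} refl refl =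
  cong₂ (λ p q → i , j , p , q) (FinP.<-irrelevant lt lt') (Decidable⇒UIP.≡-irrelevant Bool._≟_ a a')

data Side (m n : ℕ) : Fin (m + n) → Set where
  inˡ : (x : Fin m) → Side m n (x ↑ˡ n)
  inʳ : (y : Fin n) → Side m n (m ↑ʳ y)

side : ∀ m n (i : Fin (m + n)) → Side m n i
side m n i = subst (Side m n) (join-splitAt m n i) (view (splitAt m i))
  where
  view : (s : Fin m ⊎ Fin n) → Side m n (join m n s)
  view (inj₁ x) = inˡ x
  view (inj₂ y) = inʳ y

module DisjointUnion (G₁ G₂ : FinGraph) where

  private
    n₁ = n G₁
    n₂ = n G₂
    G₁₂ = G₁ ⊕ G₂

  ↑ˡ≢↑ʳ : ∀ x y → x ↑ˡ n₂ ≢ n₁ ↑ʳ y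
  ↑ˡ≢↑ʳ x y eq with trans (sym (splitAt-↑ˡ n₁ x n₂)) (trans (cong (splitAt n₁) eq) (splitAt-↑ʳ n₁ n₂ y))
  ... | ()

  adj-↑ˡ : ∀ x y → adj G₁₂ (x ↑ˡ n₂) (y ↑ˡ n₂) ≡ adj G₁ x y
  adj-↑ˡ x y rewrite splitAt-↑ˡ n₁ x n₂ | splitAt-↑ˡ n₁ y n₂ = refl

  adj-↑ʳ : ∀ x y → adj G₁₂ (n₁ ↑ʳ x) (n₁ ↑ʳ y) ≡ adj G₂ x y
  adj-↑ʳ x y rewrite splitAt-↑ʳ n₁ n₂ x | splitAt-↑ʳ n₁ n₂ y = refl

  adj-↑ˡ↑ʳ : ∀ x y → adj G₁₂ (x ↑ˡ n₂) (n₁ ↑ʳ y) ≡ false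
  adj-↑ˡ↑ʳ x y rewrite splitAt-↑ˡ n₁ x n₂ | splitAt-↑ʳ n₁ n₂ y = refl

  adj-↑ʳ↑ˡ : ∀ x y → adj G₁₂ (n₁ ↑ʳ x) (y ↑ˡ n₂) ≡ false
  adj-↑ʳ↑ˡ x y rewrite splitAt-↑ʳ n₁ n₂ x | splitAt-↑ˡ n₁ y n₂ = refl

  ⊕-≅ : toGraph G₁ ⊎ᴳ toGraph G₂ ≅ toGraph G₁₂
  ⊕-≅ = record
    { to = join n₁ n₂ ; from = splitAt n₁ ; from∘to = splitAt-join n₁ n₂ ; to∘from = join-splitAt n₁ n₂
    ; to-adj = to-adj }
    where
    to-adj : ∀ x y → SumAdj (toGraph G₁) (toGraph G₂) x y ⇔ (adj G₁₂ (join n₁ n₂ x) (join n₁ n₂ y) ≡ true)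
    to-adj (inj₁ x) (inj₁ y) =
      mk⇔ (λ { (left a) → trans (adj-↑ˡ x y) a }) (λ a → left (trans (sym (adj-↑ˡ x y)) a))
    to-adj (inj₂ x) (inj₂ y) =
      mk⇔ (λ { (right a) → trans (adj-↑ʳ x y) a }) (λ a → right (trans (sym (adj-↑ʳ x y)) a))
    to-adj (inj₁ x) (inj₂ y) = mk⇔ (λ ()) (λ a → contradiction (trans (sym (adj-↑ˡ↑ʳ x y)) a) λ ())
    to-adj (inj₂ x) (inj₁ y) = mk⇔ (λ ()) (λ a → contradiction (trans (sym (adj-↑ʳ↑ˡ x y)) a) λ ())

  embed : EdgeOf G₁ ⊎ EdgeOf G₂ → EdgeOf G₁₂
  embed (inj₁ (x , y , lt , a)) =
    x ↑ˡ n₂ , y ↑ˡ n₂ , subst₂ _<_ (sym (toℕ-↑ˡ x n₂)) (sym (toℕ-↑ˡ y n₂)) lt , trans (adj-↑ˡ x y) a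
  embed (inj₂ (x , y , lt , a)) =
    n₁ ↑ʳ x , n₁ ↑ʳ y , subst₂ _<_ (sym (toℕ-↑ʳ n₁ x)) (sym (toℕ-↑ʳ n₁ y)) (+-monoʳ-< n₁ lt) ,
    trans (adj-↑ʳ x y) a

  embed-injective : Injective _≡_ _≡_ embed
  embed-injective {inj₁ _} {inj₁ _} eq =
    cong inj₁ (EdgeOf-≡ {G₁} (↑ˡ-injective n₂ _ _ (cong proj₁ eq))
                             (↑ˡ-injective n₂ _ _ (cong (proj₁ ∘ proj₂) eq)))
  embed-injective {inj₂ _} {inj₂ _} eq =
    cong inj₂ (EdgeOf-≡ {G₂} (↑ʳ-injective n₁ _ _ (cong proj₁ eq))
                             (↑ʳ-injective n₁ _ _ (cong (proj₁ ∘ proj₂) eq)))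
  embed-injective {inj₁ _} {inj₂ _} eq = ⊥-elim (↑ˡ≢↑ʳ _ _ (cong proj₁ eq))
  embed-injective {inj₂ _} {inj₁ _} eq = ⊥-elim (↑ˡ≢↑ʳ _ _ (sym (cong proj₁ eq)))

  split′ : ∀ {i j} → Side n₁ n₂ i → Side n₁ n₂ j → toℕ i < toℕ j → adj G₁₂ i j ≡ true →
           EdgeOf G₁ ⊎ EdgeOf G₂
  split′ (inˡ x) (inˡ y) lt a =
    inj₁ (x , y , subst₂ _<_ (toℕ-↑ˡ x n₂) (toℕ-↑ˡ y n₂) lt , trans (sym (adj-↑ˡ x y)) a)
  split′ (inʳ x) (inʳ y) lt a =
    inj₂ (x , y , +-cancelˡ-< n₁ _ _ (subst₂ _<_ (toℕ-↑ʳ n₁ x) (toℕ-↑ʳ n₁ y) lt) ,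
          trans (sym (adj-↑ʳ x y)) a)
  split′ (inˡ x) (inʳ y) lt a = contradiction (trans (sym (adj-↑ˡ↑ʳ x y)) a) λ ()
  split′ (inʳ x) (inˡ y) lt a = contradiction (trans (sym (adj-↑ʳ↑ˡ x y)) a) λ ()

  split : EdgeOf G₁₂ → EdgeOf G₁ ⊎ EdgeOf G₂
  split (i , j , lt , a) = split′ (side n₁ n₂ i) (side n₁ n₂ j) lt a

  embed∘split′ : ∀ {i j} (si : Side n₁ n₂ i) (sj : Side n₁ n₂ j) lt a →
                 src {G₁₂} (embed (split′ si sj lt a)) ≡ i × tgt {G₁₂} (embed (split′ si sj lt a)) ≡ j
  embed∘split′ (inˡ x) (inˡ y) lt a = refl , refl
  embed∘split′ (inʳ x) (inʳ y) lt a = refl , refl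
  embed∘split′ (inˡ x) (inʳ y) lt a = contradiction (trans (sym (adj-↑ˡ↑ʳ x y)) a) λ ()
  embed∘split′ (inʳ x) (inˡ y) lt a = contradiction (trans (sym (adj-↑ʳ↑ˡ x y)) a) λ ()

  embed∘split : ∀ e → embed (split e) ≡ e
  embed∘split (i , j , lt , a) =
    let s , t = embed∘split′ (side n₁ n₂ i) (side n₁ n₂ j) lt a in EdgeOf-≡ {G₁₂} s t

  L-⊕-≅ : L G₁ ⊎ᴳ L G₂ ≅ L G₁₂
  L-⊕-≅ = record
    { to = embed ; from = split ; from∘to = λ x → embed-injective (embed∘split (embed x))
    ; to∘from = embed∘split ; to-adj = to-adj }
    where
    to-adj : ∀ x y → SumAdj (L G₁) (L G₂) x y ⇔ Adj (L G₁₂) (embed x) (embed y)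
    to-adj (inj₁ _) (inj₁ _) = mk⇔
      (λ { (left (ne , m)) → (λ eq → ne (inj₁-injective (embed-injective eq))) , Meet-map (_↑ˡ n₂) m })
      (λ (ne , m) → left ((λ eq → ne (cong (embed ∘ inj₁) eq)) , Meet-unmap (↑ˡ-injective n₂ _ _) m))
    to-adj (inj₂ _) (inj₂ _) = mk⇔
      (λ { (right (ne , m)) → (λ eq → ne (inj₂-injective (embed-injective eq))) , Meet-map (n₁ ↑ʳ_) m })
      (λ (ne , m) → right ((λ eq → ne (cong (embed ∘ inj₂) eq)) , Meet-unmap (↑ʳ-injective n₁ _ _) m))
    to-adj (inj₁ _) (inj₂ _) = mk⇔ (λ ()) (λ (_ , m) → ⊥-elim (Meet-disjoint ↑ˡ≢↑ʳ m))
    to-adj (inj₂ _) (inj₁ _) = mk⇔ (λ ()) (λ (_ , m) → ⊥-elim (Meet-disjoint (λ x y → ↑ˡ≢↑ʳ y x ∘ sym) m))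

Intersection-copies : ∀ {k G H} → Intersection ℕ k (L G) (toGraph H) →
                      ∀ t → Intersection ℕ k (L (copies t G)) (toGraph (copies t H))
Intersection-copies I zero = Intersection-empty (λ ()) (λ ())
Intersection-copies {G = G} {H} I (suc t) =
  Intersection-resp-≅ (DisjointUnion.L-⊕-≅ G (copies t G)) (DisjointUnion.⊕-≅ H (copies t H))
    (Intersection-encode interleave interleave-injective (Intersection-⊎ I (Intersection-copies I t)))

-- Spiders

data Leg : Set where
  A B C : Leg

-- pt X k is the vertex at distance k + 1 from the centre on leg X.
data Point : Set where
  ctr : Point
  pt  : Leg → ℕ → Point

data _⋖_ : Point → Point → Set where
  root : ∀ {X} → ctr ⋖ pt X 0
  leg  : ∀ {X k} → pt X k ⋖ pt X (suc k)

⋖-irrelevant : ∀ {x y} (p q : x ⋖ y) → p ≡ q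
⋖-irrelevant root root = refl
⋖-irrelevant leg  leg  = refl

⋖-parent-unique : ∀ {x x' y} → x ⋖ y → x' ⋖ y → x ≡ x'
⋖-parent-unique root root = refl
⋖-parent-unique leg  leg  = refl

Adjacent : Point → Point → Set
Adjacent x y = x ⋖ y ⊎ y ⋖ x

parent : Leg → ℕ → Point
parent X zero    = ctr
parent X (suc k) = pt X k

parent-⋖ : ∀ X k → parent X k ⋖ pt X k
parent-⋖ X zero    = root
parent-⋖ X (suc k) = leg

-- (X , k) is the edge from pt X k to its parent; LineAdj is adjacency in the line graph of the
-- spider with infinite legs.
data LineAdj : Leg × ℕ → Leg × ℕ → Set where
  hub  : ∀ {X Y} → X ≢ Y → LineAdj (X , 0) (Y , 0)
  next : ∀ {X k} → LineAdj (X , k) (X , suc k)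
  prev : ∀ {X k} → LineAdj (X , suc k) (X , k)

LineAdj-sym : ∀ {e e'} → LineAdj e e' → LineAdj e' e
LineAdj-sym (hub X≢Y) = hub (X≢Y ∘ sym)
LineAdj-sym next      = prev
LineAdj-sym prev      = next

LineAdj⇒Meet : ∀ {X k Y l} → LineAdj (X , k) (Y , l) →
               (X , k) ≢ (Y , l) × Meet (parent X k) (pt X k) (parent Y l) (pt Y l)
LineAdj⇒Meet (hub X≢Y)  = X≢Y ∘ cong proj₁ , inj₁ (inj₁ refl)
LineAdj⇒Meet next       = 1+n≢n ∘ sym ∘ cong proj₂ , inj₂ (inj₁ refl)
LineAdj⇒Meet prev       = 1+n≢n ∘ cong proj₂ , inj₁ (inj₂ refl)

Meet⇒LineAdj : ∀ {X k Y l} → (X , k) ≢ (Y , l) →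
               Meet (parent X k) (pt X k) (parent Y l) (pt Y l) → LineAdj (X , k) (Y , l)
Meet⇒LineAdj {k = zero}  {l = zero}  ne (inj₁ (inj₁ _))    = hub λ { refl → ne refl }
Meet⇒LineAdj {k = suc _} {l = suc _} ne (inj₁ (inj₁ refl)) = ⊥-elim (ne refl)
Meet⇒LineAdj {k = zero}  {l = suc _} ne (inj₁ (inj₁ ()))
Meet⇒LineAdj {k = zero}  {l = suc _} ne (inj₁ (inj₂ ()))
Meet⇒LineAdj {k = suc _}             ne (inj₁ (inj₂ refl)) = prev
Meet⇒LineAdj             {l = suc _} ne (inj₂ (inj₁ refl)) = next
Meet⇒LineAdj                         ne (inj₂ (inj₂ refl)) = ⊥-elim (ne refl)

T-≡ᵇ : ∀ {m n} → T (m ≡ᵇ n) ⇔ m ≡ n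
T-≡ᵇ {m} {n} = mk⇔ (≡ᵇ⇒≡ m n) (≡⇒≡ᵇ m n)

T-not-≡ᵇ : ∀ {m n} → T (not (m ≡ᵇ n)) ⇔ m ≢ n
T-not-≡ᵇ {m} {n} = mk⇔ T-not⇒≢ ≢⇒T-not
  where
  T-not⇒≢ : T (not (m ≡ᵇ n)) → m ≢ n
  T-not⇒≢ t refl with trans (sym (⇒ T-not-≡ t)) (⇒ T-≡ (≡⇒≡ᵇ m m refl))
  ... | ()
  ≢⇒T-not : m ≢ n → T (not (m ≡ᵇ n))
  ≢⇒T-not m≢n with m ≡ᵇ n in eq
  ... | false = tt
  ... | true  = m≢n (≡ᵇ⇒≡ m n (subst T (sym eq) tt))

module _ (a b c : ℕ) where

  T-step-ctr : ∀ v → T (step a b c 0 v) ⇔ (v ≡ 1 ⊎ v ≡ suc a ⊎ v ≡ suc (a + b))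
  T-step-ctr v = ⇔-trans (T-∨ {v ≡ᵇ 1}) (T-≡ᵇ ⊎-⇔ ⇔-trans (T-∨ {v ≡ᵇ suc a}) (T-≡ᵇ ⊎-⇔ T-≡ᵇ))

  T-step-suc : ∀ u v → T (step a b c (suc u) v) ⇔ (v ≡ suc (suc u) × suc u ≢ a × suc u ≢ a + b)
  T-step-suc u v =
    ⇔-trans (T-∧ {v ≡ᵇ suc (suc u)}) (T-≡ᵇ ×-⇔ ⇔-trans (T-∧ {not (suc u ≡ᵇ a)}) (T-not-≡ᵇ ×-⇔ T-not-≡ᵇ))

module Spider (a b c : ℕ) (0<a : 0 < a) (0<b : 0 < b) (0<c : 0 < c) where

  len : Leg → ℕ
  len A = a
  len B = b
  len C = c

  off : Leg → ℕ
  off A = 0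
  off B = a
  off C = a + b

  InSpider : Point → Set
  InSpider ctr      = ⊤
  InSpider (pt X k) = k < len X

  Vertex : Set
  Vertex = Σ Point InSpider

  Vertex-≡ : ∀ {u v : Vertex} → proj₁ u ≡ proj₁ v → u ≡ v
  Vertex-≡ {ctr , tt}    {.ctr , tt}   refl = refl
  Vertex-≡ {pt X k , p} {.(pt X k) , q} refl = cong (pt X k ,_) (<-irrelevant p q)

  -- The number of a point in the vertex set Fin (suc (a + b + c)) of S a b c
  index : Point → ℕ
  index ctr      = 0
  index (pt X k) = suc (off X + k)

  N : ℕ
  N = a + b + c

  index-pt≤leg-end : ∀ X k → k < len X → index (pt X k) ≤ off X + len X
  index-pt≤leg-end X k k<len =
    subst (_≤ off X + len X) (+-suc (off X) k) (+-monoʳ-≤ (off X) k<len)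

  leg-end≤N : ∀ X → off X + len X ≤ N
  leg-end≤N A = ≤-trans (m≤m+n a b) (m≤m+n (a + b) c)
  leg-end≤N B = m≤m+n (a + b) c
  leg-end≤N C = ≤-refl

  index≤N : ∀ x → InSpider x → index x ≤ N
  index≤N ctr      _      = z≤n
  index≤N (pt X k) k<len = ≤-trans (index-pt≤leg-end X k k<len) (leg-end≤N X)

  data Before : Leg → Leg → Set where
    AB : Before A B
    AC : Before A C
    BC : Before B C

  Before⇒index< : ∀ {X Y} → Before X Y → ∀ k l → k < len X → index (pt X k) < index (pt Y l)
  Before⇒index< {X} {Y} X<Y k l k<len =
    s≤s (≤-trans (index-pt≤leg-end X k k<len) (≤-trans (end≤off X<Y) (m≤m+n (off Y) l)))
    where
    end≤off : ∀ {X Y} → Before X Y → off X + len X ≤ off Y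
    end≤off AB = ≤-refl
    end≤off AC = m≤m+n a b
    end≤off BC = ≤-refl

  index-injective : ∀ {x y} → InSpider x → InSpider y → index x ≡ index y → x ≡ y
  index-injective {ctr}    {ctr}    _ _ _ = refl
  index-injective {pt A k} {pt A l} _ _ eq = cong (pt A) (suc-injective eq)
  index-injective {pt B k} {pt B l} _ _ eq = cong (pt B) (+-cancelˡ-≡ a k l (suc-injective eq))
  index-injective {pt C k} {pt C l} _ _ eq = cong (pt C) (+-cancelˡ-≡ (a + b) k l (suc-injective eq))
  index-injective {pt A k} {pt B l} p _ eq = contradiction eq (<⇒≢ (Before⇒index< AB k l p))
  index-injective {pt A k} {pt C l} p _ eq = contradiction eq (<⇒≢ (Before⇒index< AC k l p))
  index-injective {pt B k} {pt C l} p _ eq = contradiction eq (<⇒≢ (Before⇒index< BC k l p))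
  index-injective {pt B k} {pt A l} _ q eq = contradiction eq (>⇒≢ (Before⇒index< AB l k q))
  index-injective {pt C k} {pt A l} _ q eq = contradiction eq (>⇒≢ (Before⇒index< AC l k q))
  index-injective {pt C k} {pt B l} _ q eq = contradiction eq (>⇒≢ (Before⇒index< BC l k q))

  pointAt : ∀ m → m ≤ N → Σ[ v ∈ Vertex ] index (proj₁ v) ≡ m
  pointAt zero    _ = (ctr , tt) , refl
  pointAt (suc m) m<N with m <? a
  ... | yes m<a = (pt A m , m<a) , refl
  ... | no m≮a with m ∸ a <? b
  ...   | yes r = (pt B (m ∸ a) , r) , cong suc (m+[n∸m]≡n (≮⇒≥ m≮a))
  ...   | no r  = (pt C d , d<c) , cong suc a+b+d≡m
    where
    open ≡-Reasoning
    d = m ∸ a ∸ b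
    a+b+d≡m : a + b + d ≡ m
    a+b+d≡m = begin
      a + b + d    ≡⟨ +-assoc a b d ⟩
      a + (b + d)  ≡⟨ cong (a +_) (m+[n∸m]≡n (≮⇒≥ r)) ⟩
      a + (m ∸ a)  ≡⟨ m+[n∸m]≡n (≮⇒≥ m≮a) ⟩
      m            ∎
    d<c : d < c
    d<c = +-cancelˡ-≤ (a + b) (suc d) c
            (subst (_≤ N) (trans (cong suc (sym a+b+d≡m)) (sym (+-suc (a + b) d))) m<N)

  inner≢a : ∀ X k → suc k < len X → suc (off X + k) ≢ a
  inner≢a A k k+1<a = <⇒≢ k+1<a
  inner≢a B k _     = >⇒≢ (s≤s (m≤m+n a k))
  inner≢a C k _     = >⇒≢ (s≤s (≤-trans (m≤m+n a b) (m≤m+n (a + b) k)))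

  inner≢a+b : ∀ X k → suc k < len X → suc (off X + k) ≢ a + b
  inner≢a+b A k k+1<a = <⇒≢ (≤-trans k+1<a (m≤m+n a b))
  inner≢a+b B k k+1<b = <⇒≢ (subst (_< a + b) (+-suc a k) (+-monoʳ-< a k+1<b))
  inner≢a+b C k _     = >⇒≢ (s≤s (m≤m+n (a + b) k))

  root-at : ∀ {y} X → InSpider (pt X 0) → InSpider y → index y ≡ index (pt X 0) → ctr ⋖ y
  root-at X p q eq with index-injective q p eq
  ... | refl = root

  ⋖⇒step : ∀ {x y} → InSpider y → x ⋖ y → T (step a b c (index x) (index y))
  ⋖⇒step _ (root {A}) = ⇐ (T-step-ctr a b c _) (inj₁ refl)
  ⋖⇒step _ (root {B}) = ⇐ (T-step-ctr a b c _) (inj₂ (inj₁ (cong suc (+-identityʳ a))))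
  ⋖⇒step _ (root {C}) = ⇐ (T-step-ctr a b c _) (inj₂ (inj₂ (cong suc (+-identityʳ (a + b)))))
  ⋖⇒step {pt X k} k+1<len leg = ⇐ (T-step-suc a b c _ _)
    (cong suc (+-suc (off X) k) , inner≢a X k k+1<len , inner≢a+b X k k+1<len)

  step⇒⋖ : ∀ {x y} → InSpider x → InSpider y → T (step a b c (index x) (index y)) → x ⋖ y
  step⇒⋖ {ctr} _ q s with ⇒ (T-step-ctr a b c _) s
  ... | inj₁ eq        = root-at A 0<a q eq
  ... | inj₂ (inj₁ eq) = root-at B 0<b q (trans eq (cong suc (sym (+-identityʳ a))))
  ... | inj₂ (inj₂ eq) = root-at C 0<c q (trans eq (cong suc (sym (+-identityʳ (a + b)))))
  step⇒⋖ {pt X k} k<len q s with ⇒ (T-step-suc a b c _ _) s | m≤n⇒m<n∨m≡n k<len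
  ... | eq , _ | inj₁ k+1<len with index-injective q k+1<len (trans eq (cong suc (sym (+-suc (off X) k))))
  ...   | refl = leg
  step⇒⋖ {pt A k} _ _ _ | _ , ≢a , _ | inj₂ k+1≡a = contradiction k+1≡a ≢a
  step⇒⋖ {pt B k} _ _ _ | _ , _ , ≢a+b | inj₂ k+1≡b =
    contradiction (trans (sym (+-suc a k)) (cong (a +_) k+1≡b)) ≢a+b
  step⇒⋖ {pt C k} {y} _ q _ | eq , _ | inj₂ k+1≡c = ⊥-elim (1+n≰n (begin-strict
      N                     ≡⟨ cong (a + b +_) (sym k+1≡c) ⟩
      a + b + suc k         ≡⟨ +-suc (a + b) k ⟩
      suc (a + b + k)       <⟨ ≤-refl ⟩
      suc (suc (a + b + k)) ≡⟨ sym eq ⟩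
      index y               ≤⟨ index≤N y q ⟩
      N                     ∎))
    where open ≤-Reasoning

  Spider : Graph
  Spider = record { V = Vertex ; Adj = λ u v → Adjacent (proj₁ u) (proj₁ v) }

  toFin : Vertex → Fin (suc N)
  toFin (x , p) = fromℕ< (s≤s (index≤N x p))

  toℕ-toFin : ∀ v → toℕ (toFin v) ≡ index (proj₁ v)
  toℕ-toFin (x , p) = toℕ-fromℕ< (s≤s (index≤N x p))

  fromFin : Fin (suc N) → Vertex
  fromFin i = proj₁ (pointAt (toℕ i) (toℕ≤pred[n] i))

  index-fromFin : ∀ i → index (proj₁ (fromFin i)) ≡ toℕ i
  index-fromFin i = proj₂ (pointAt (toℕ i) (toℕ≤pred[n] i))

  adj-toFin : ∀ u v → adj (S a b c) (toFin u) (toFin v) ≡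
              step a b c (index (proj₁ u)) (index (proj₁ v)) ∨ step a b c (index (proj₁ v)) (index (proj₁ u))
  adj-toFin u v rewrite toℕ-toFin u | toℕ-toFin v = refl

  spider-≅ : Spider ≅ toGraph (S a b c)
  spider-≅ = record
    { to      = toFin
    ; from    = fromFin
    ; from∘to = λ v → Vertex-≡ (index-injective (proj₂ (fromFin (toFin v))) (proj₂ v)
                               (trans (index-fromFin (toFin v)) (toℕ-toFin v)))
    ; to∘from = λ i → toℕ-injective (trans (toℕ-toFin (fromFin i)) (index-fromFin i))
    ; to-adj  = λ u v → mk⇔
        (λ x~y → trans (adj-toFin u v)
                   (⇒ T-≡ (⇐ T-∨ (Sum.map (⋖⇒step (proj₂ v)) (⋖⇒step (proj₂ u)) x~y))))
        (λ a → Sum.map (step⇒⋖ (proj₂ u) (proj₂ v)) (step⇒⋖ (proj₂ v) (proj₂ u))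
                       (⇒ T-∨ (⇐ T-≡ (trans (sym (adj-toFin u v)) a))))
    }

  ⋖⇒index< : ∀ {x y} → x ⋖ y → index x < index y
  ⋖⇒index< root           = s≤s z≤n
  ⋖⇒index< (leg {X} {k}) = s≤s (≤-reflexive (sym (+-suc (off X) k)))

  Link : Set
  Link = Σ[ u ∈ Vertex ] Σ[ v ∈ Vertex ] proj₁ u ⋖ proj₁ v

  Link-≡ : ∀ {e e' : Link} → proj₁ e ≡ proj₁ e' → proj₁ (proj₂ e) ≡ proj₁ (proj₂ e') → e ≡ e'
  Link-≡ {u , v , r} {.u , .v , r'} refl refl = cong (λ r → u , v , r) (⋖-irrelevant r r')

  Links : Graph
  Links = record
    { V   = Link
    ; Adj = λ e e' → e ≢ e' × Meet (proj₁ e) (proj₁ (proj₂ e)) (proj₁ e') (proj₁ (proj₂ e')) }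

  links-≅ : Links ≅ L (S a b c)
  links-≅ = record
    { to = linkToEdge ; from = edgeToLink
    ; from∘to = edgeToLink∘linkToEdge ; to∘from = linkToEdge∘edgeToLink
    ; to-adj = λ e e' → mk⇔
        (λ (ne , m) → ne ∘ linkToEdge-injective , Meet-map toFin m)
        (λ (ne , m) → ne ∘ cong linkToEdge , Meet-unmap (_≅_.to-injective spider-≅) m) }
    where
    module Sp = _≅_ spider-≅

    linkToEdge : Link → EdgeOf (S a b c)
    linkToEdge (u , v , r) =
      toFin u , toFin v , subst₂ _<_ (sym (toℕ-toFin u)) (sym (toℕ-toFin v)) (⋖⇒index< r) ,
      ⇒ (Sp.to-adj u v) (inj₁ r)

    orient : ∀ i j → toℕ i < toℕ j → adj (S a b c) i j ≡ true → proj₁ (fromFin i) ⋖ proj₁ (fromFin j)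
    orient i j i<j a with ⇒ (Sp.from-adj i j) a
    ... | inj₁ r = r
    ... | inj₂ r = contradiction (subst₂ _<_ (index-fromFin j) (index-fromFin i) (⋖⇒index< r)) (<-asym i<j)

    edgeToLink : EdgeOf (S a b c) → Link
    edgeToLink (i , j , i<j , a) = fromFin i , fromFin j , orient i j i<j a

    edgeToLink∘linkToEdge : ∀ e → edgeToLink (linkToEdge e) ≡ e
    edgeToLink∘linkToEdge (u , v , r) = Link-≡ (Sp.from∘to u) (Sp.from∘to v)

    linkToEdge∘edgeToLink : ∀ e → linkToEdge (edgeToLink e) ≡ e
    linkToEdge∘edgeToLink (i , j , _ , _) = EdgeOf-≡ {S a b c} (Sp.to∘from i) (Sp.to∘from j)

    linkToEdge-injective : Injective _≡_ _≡_ linkToEdge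
    linkToEdge-injective {e} {e'} eq =
      trans (sym (edgeToLink∘linkToEdge e)) (trans (cong edgeToLink eq) (edgeToLink∘linkToEdge e'))

  InLeg : Leg × ℕ → Set
  InLeg (X , k) = k < len X

  InLeg-≡ : ∀ {e e' : Σ (Leg × ℕ) InLeg} → proj₁ e ≡ proj₁ e' → e ≡ e'
  InLeg-≡ {_ , p} {_ , q} refl = cong (_ ,_) (<-irrelevant p q)

  SpiderLine : Graph
  SpiderLine = record { V = Σ (Leg × ℕ) InLeg ; Adj = λ e e' → LineAdj (proj₁ e) (proj₁ e') }

  parent-in : ∀ X k → k < len X → InSpider (parent X k)
  parent-in X zero    _       = tt
  parent-in X (suc k) k+1<len = <⇒≤ k+1<len

  line-≅ : SpiderLine ≅ Links
  line-≅ = record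
    { to = to ; from = from ; from∘to = λ _ → refl ; to∘from = to∘from
    ; to-adj = λ e e' → mk⇔
        (λ adj → let ne , m = LineAdj⇒Meet adj in ne ∘ cong (proj₁ ∘ from) , Meet-unmap Vertex-≡ m)
        (λ (ne , m) → Meet⇒LineAdj (λ eq → ne (cong to (InLeg-≡ eq))) (Meet-map proj₁ m)) }
    where
    to : Σ (Leg × ℕ) InLeg → Link
    to ((X , k) , k<len) = (parent X k , parent-in X k k<len) , (pt X k , k<len) , parent-⋖ X k

    from : Link → Σ (Leg × ℕ) InLeg
    from (_ , (ctr , _) , ())
    from (_ , (pt X k , k<len) , _) = (X , k) , k<len

    to∘from : ∀ e → to (from e) ≡ e
    to∘from (_ , (ctr , _) , ())
    to∘from (_ , (pt X k , _) , r) = Link-≡ (Vertex-≡ (⋖-parent-unique (parent-⋖ X k) r)) refl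

  spiderLine-≅ : SpiderLine ≅ L (S a b c)
  spiderLine-≅ = ≅-trans line-≅ links-≅

-- Two labellings of L(S_{q,q,q})

twist : Point → Point
twist ctr            = ctr
twist (pt A zero)    = pt A zero
twist (pt A (suc k)) = pt C k
twist (pt B k)       = pt B k
twist (pt C k)       = pt A (suc k)

twist-involutive : ∀ x → twist (twist x) ≡ x
twist-involutive ctr            = refl
twist-involutive (pt A zero)    = refl
twist-involutive (pt A (suc k)) = refl
twist-involutive (pt B k)       = refl
twist-involutive (pt C k)       = refl

twist-injective : Injective _≡_ _≡_ twist
twist-injective {x} {y} eq = trans (sym (twist-involutive x)) (trans (cong twist eq) (twist-involutive y))

toPoint : Leg × ℕ → Point
toPoint (X , k) = pt X k

toPoint-injective : Injective _≡_ _≡_ toPoint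
toPoint-injective {_ , _} {_ , _} refl = refl

-- A vertex x of S_{q-1,q-1,q} becomes the common label lift x, carried by the edge edge₁ x in the
-- first copy and by edge₂ x in the second.
edge₁ edge₂ : Point → Leg × ℕ
edge₁ ctr      = A , 0
edge₁ (pt A k) = A , suc k
edge₁ (pt B k) = C , k
edge₁ (pt C k) = B , k
edge₂ ctr      = A , 0
edge₂ (pt A k) = C , k
edge₂ (pt B k) = A , suc k
edge₂ (pt C k) = B , k

lift : Point → Point
lift = toPoint ∘ edge₁

twist-edge₂ : ∀ x → twist (toPoint (edge₂ x)) ≡ lift x
twist-edge₂ ctr      = refl
twist-edge₂ (pt A k) = refl
twist-edge₂ (pt B k) = refl
twist-edge₂ (pt C k) = refl

unlift : Point → Point
unlift (pt A zero)    = ctr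
unlift (pt A (suc k)) = pt A k
unlift (pt B k)       = pt C k
unlift (pt C k)       = pt B k
unlift ctr            = ctr

lift-injective : Injective _≡_ _≡_ lift
lift-injective {x} {y} eq = trans (sym (unlift∘lift x)) (trans (cong unlift eq) (unlift∘lift y))
  where
  unlift∘lift : ∀ x → unlift (lift x) ≡ x
  unlift∘lift ctr      = refl
  unlift∘lift (pt A k) = refl
  unlift∘lift (pt B k) = refl
  unlift∘lift (pt C k) = refl

⋖⇒LineAdj₁ : ∀ {x y} → x ⋖ y → LineAdj (edge₁ x) (edge₁ y)
⋖⇒LineAdj₁ (root {A}) = next
⋖⇒LineAdj₁ (root {B}) = hub λ ()
⋖⇒LineAdj₁ (root {C}) = hub λ ()
⋖⇒LineAdj₁ (leg {A})  = next
⋖⇒LineAdj₁ (leg {B})  = next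
⋖⇒LineAdj₁ (leg {C})  = next

⋖⇒LineAdj₂ : ∀ {x y} → x ⋖ y → LineAdj (edge₂ x) (edge₂ y)
⋖⇒LineAdj₂ (root {A}) = hub λ ()
⋖⇒LineAdj₂ (root {B}) = next
⋖⇒LineAdj₂ (root {C}) = hub λ ()
⋖⇒LineAdj₂ (leg {A})  = next
⋖⇒LineAdj₂ (leg {B})  = next
⋖⇒LineAdj₂ (leg {C})  = next

Adjacent⇒LineAdj : ∀ {ε : Point → Leg × ℕ} → (∀ {x y} → x ⋖ y → LineAdj (ε x) (ε y)) →
                   ∀ {x y} → Adjacent x y → LineAdj (ε x) (ε y)
Adjacent⇒LineAdj ⋖⇒ = [ ⋖⇒ , LineAdj-sym ∘ ⋖⇒ ]

-- The first copy alone also joins pt B 0 and pt C 0; the second copy separates them.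
LineAdj₁₂⇒Adjacent : ∀ x y → LineAdj (edge₁ x) (edge₁ y) → LineAdj (edge₂ x) (edge₂ y) → Adjacent x y
LineAdj₁₂⇒Adjacent ctr ctr (hub ne) _ = ⊥-elim (ne refl)
LineAdj₁₂⇒Adjacent ctr (pt A zero)    _  _ = inj₁ root
LineAdj₁₂⇒Adjacent ctr (pt A (suc _)) () _
LineAdj₁₂⇒Adjacent ctr (pt B zero)    _  _ = inj₁ root
LineAdj₁₂⇒Adjacent ctr (pt B (suc _)) () _
LineAdj₁₂⇒Adjacent ctr (pt C zero)    _  _ = inj₁ root
LineAdj₁₂⇒Adjacent ctr (pt C (suc _)) () _
LineAdj₁₂⇒Adjacent (pt A zero)    ctr _  _ = inj₂ root
LineAdj₁₂⇒Adjacent (pt A (suc _)) ctr () _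
LineAdj₁₂⇒Adjacent (pt B zero)    ctr _  _ = inj₂ root
LineAdj₁₂⇒Adjacent (pt B (suc _)) ctr () _
LineAdj₁₂⇒Adjacent (pt C zero)    ctr _  _ = inj₂ root
LineAdj₁₂⇒Adjacent (pt C (suc _)) ctr () _
LineAdj₁₂⇒Adjacent (pt A _) (pt A _) next     _ = inj₁ leg
LineAdj₁₂⇒Adjacent (pt A _) (pt A _) prev     _ = inj₂ leg
LineAdj₁₂⇒Adjacent (pt B _) (pt B _) (hub ne) _ = ⊥-elim (ne refl)
LineAdj₁₂⇒Adjacent (pt B _) (pt B _) next     _ = inj₁ leg
LineAdj₁₂⇒Adjacent (pt B _) (pt B _) prev     _ = inj₂ leg
LineAdj₁₂⇒Adjacent (pt C _) (pt C _) (hub ne) _ = ⊥-elim (ne refl)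
LineAdj₁₂⇒Adjacent (pt C _) (pt C _) next     _ = inj₁ leg
LineAdj₁₂⇒Adjacent (pt C _) (pt C _) prev     _ = inj₂ leg
LineAdj₁₂⇒Adjacent (pt A _) (pt B _) () _
LineAdj₁₂⇒Adjacent (pt A _) (pt C _) () _
LineAdj₁₂⇒Adjacent (pt B _) (pt A _) () _
LineAdj₁₂⇒Adjacent (pt C _) (pt A _) () _
LineAdj₁₂⇒Adjacent (pt B _) (pt C _) (hub _) ()
LineAdj₁₂⇒Adjacent (pt C _) (pt B _) (hub _) ()

legCode : Leg → ℕ → ℕ ⊎ ℕ
legCode A k = inj₁ k
legCode B k = inj₂ (interleave (inj₁ k))
legCode C k = inj₂ (interleave (inj₂ k))

legCode-injective : ∀ {X k Y l} → legCode X k ≡ legCode Y l → pt X k ≡ pt Y l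
legCode-injective {A} {Y = A} refl = refl
legCode-injective {B} {k} {B} {l} eq with interleave-injective {inj₁ k} {inj₁ l} (inj₂-injective eq)
... | refl = refl
legCode-injective {C} {k} {C} {l} eq with interleave-injective {inj₂ k} {inj₂ l} (inj₂-injective eq)
... | refl = refl
legCode-injective {B} {k} {C} {l} eq with interleave-injective {inj₁ k} {inj₂ l} (inj₂-injective eq)
... | ()
legCode-injective {C} {k} {B} {l} eq with interleave-injective {inj₂ k} {inj₁ l} (inj₂-injective eq)
... | ()
legCode-injective {A} {Y = B} ()
legCode-injective {A} {Y = C} ()
legCode-injective {B} {Y = A} ()
legCode-injective {C} {Y = A} ()

encodePoint : Point → ℕ
encodePoint ctr      = 0
encodePoint (pt X k) = suc (interleave (legCode X k))

encodePoint-injective : Injective _≡_ _≡_ encodePoint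
encodePoint-injective {ctr}    {ctr}    _  = refl
encodePoint-injective {ctr}    {pt _ _} ()
encodePoint-injective {pt _ _} {ctr}    ()
encodePoint-injective {pt _ _} {pt _ _} eq = legCode-injective (interleave-injective (suc-injective eq))

module TwoCopies (p : ℕ) where

  private
    q = suc (suc p)
    module G = Spider q q q z<s z<s z<s
    module H = Spider (suc p) (suc p) q z<s z<s z<s

  edge₁-in : ∀ x → H.InSpider x → G.InLeg (edge₁ x)
  edge₁-in ctr      _   = z<s
  edge₁-in (pt A k) k<n = s≤s k<n
  edge₁-in (pt B k) k<n = m<n⇒m<1+n k<n
  edge₁-in (pt C k) k<q = k<q

  edge₂-in : ∀ x → H.InSpider x → G.InLeg (edge₂ x)
  edge₂-in ctr      _   = z<s
  edge₂-in (pt A k) k<n = m<n⇒m<1+n k<n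
  edge₂-in (pt B k) k<n = s≤s k<n
  edge₂-in (pt C k) k<q = k<q

  lift-onto : ∀ {X k Y l} → G.InLeg (X , k) → G.InLeg (Y , l) → twist (pt Y l) ≡ pt X k →
              Σ[ h ∈ H.Vertex ] lift (proj₁ h) ≡ pt X k
  lift-onto {A} {zero}  _      _   _    = (ctr , tt) , refl
  lift-onto {A} {suc k} k+1<q _   _    = (pt A k , ≤-pred k+1<q) , refl
  lift-onto {B} {k}     k<q   _   _    = (pt C k , k<q) , refl
  lift-onto {C} {Y = A} {suc l} _ l<q refl = (pt B l , ≤-pred l<q) , refl
  lift-onto {C} {Y = A} {zero}  _ _   ()
  lift-onto {C} {Y = B}         _ _   ()
  lift-onto {C} {Y = C}         _ _   ()

  line-intersection : Intersection Point 1 G.SpiderLine H.Spider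
  line-intersection = α , α-inj , record
    { f = f ; f-inj = f-inj ; vert→ = vert→ ; vert← = vert← ; edge→ = edge→ ; edge← = edge← }
    where
    α : Fin 2 → V G.SpiderLine → Point
    α Fin.zero           = toPoint ∘ proj₁
    α (Fin.suc Fin.zero) = twist ∘ toPoint ∘ proj₁

    α-inj : ∀ i → Injective _≡_ _≡_ (α i)
    α-inj Fin.zero           = G.InLeg-≡ ∘ toPoint-injective
    α-inj (Fin.suc Fin.zero) = G.InLeg-≡ ∘ toPoint-injective ∘ twist-injective

    f : H.Vertex → Point
    f = lift ∘ proj₁

    f-inj : Injective _≡_ _≡_ f
    f-inj = H.Vertex-≡ ∘ lift-injective

    vert→ : ∀ u → (∀ i → ∃[ v ] α i v ≡ u) → ∃[ h ] f h ≡ u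
    vert→ u P with P Fin.zero | P (Fin.suc Fin.zero)
    ... | (_ , e₁∈) , refl | (_ , e₂∈) , eq = lift-onto e₁∈ e₂∈ eq

    vert← : ∀ u → (∃[ h ] f h ≡ u) → ∀ i → ∃[ v ] α i v ≡ u
    vert← _ ((x , x∈) , refl) Fin.zero           = (edge₁ x , edge₁-in x x∈) , refl
    vert← _ ((x , x∈) , refl) (Fin.suc Fin.zero) = (edge₂ x , edge₂-in x x∈) , twist-edge₂ x

    edge→ : ∀ h h' → Adjacent (proj₁ h) (proj₁ h') →
            ∀ i → ∃[ v ] ∃[ w ] (α i v ≡ f h × α i w ≡ f h' × LineAdj (proj₁ v) (proj₁ w))
    edge→ (x , x∈) (y , y∈) x~y Fin.zero =
      (edge₁ x , edge₁-in x x∈) , (edge₁ y , edge₁-in y y∈) , refl , refl ,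
      Adjacent⇒LineAdj ⋖⇒LineAdj₁ x~y
    edge→ (x , x∈) (y , y∈) x~y (Fin.suc Fin.zero) =
      (edge₂ x , edge₂-in x x∈) , (edge₂ y , edge₂-in y y∈) , twist-edge₂ x , twist-edge₂ y ,
      Adjacent⇒LineAdj ⋖⇒LineAdj₂ x~y

    edge← : ∀ h h' → (∀ i → ∃[ v ] ∃[ w ] (α i v ≡ f h × α i w ≡ f h' × LineAdj (proj₁ v) (proj₁ w))) →
            Adjacent (proj₁ h) (proj₁ h')
    edge← (x , _) (y , _) P with P Fin.zero | P (Fin.suc Fin.zero)
    ... | _ , _ , p₁ , q₁ , r₁ | _ , _ , p₂ , q₂ , r₂ = LineAdj₁₂⇒Adjacent x y
      (subst₂ LineAdj (toPoint-injective p₁) (toPoint-injective q₁) r₁)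
      (subst₂ LineAdj (second x p₂) (second y q₂) r₂)
      where
      second : ∀ {e} x → twist (toPoint e) ≡ lift x → e ≡ edge₂ x
      second x eq = toPoint-injective (twist-injective (trans eq (sym (twist-edge₂ x))))

  spider-intersection : Intersection ℕ 1 (L (S q q q)) (toGraph (S (suc p) (suc p) q))
  spider-intersection = Intersection-resp-≅ G.spiderLine-≅ H.spider-≅
    (Intersection-encode encodePoint encodePoint-injective line-intersection)

lemma13 : (t q : ℕ) → 1 ≤ t → 2 ≤ q →
    L (copies t (S q q q)) →∩ toGraph (copies t (S (q ∸ 1) (q ∸ 1) q))
lemma13 t (suc zero)    _ (s≤s ())
lemma13 t (suc (suc p)) _ _ = Intersection⇒→∩ (Intersection-copies (TwoCopies.spider-intersection p) t)
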